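{- Let $p$ be an odd prime, let $\theta$ be a generator of the multiplicative group $\mathbb{F}_p^*$, and let $t \geq 1$ be an integer dividing $p-1$. Put $\mu = \theta^{(p-1)/t}$, $\Gamma = \mathbb{Z}_{(p-1)/t} \times \mathbb{F}_p$, and \[ S = \{ (m, \theta^m \mu^n) : m \in \mathbb{Z}_{(p-1)/t},\ 0 \leq n \leq t-1 \} \subseteq \Gamma, \] where elements $m$ of $\mathbb{Z}_{(p-1)/t}$ are identified with their least nonnegative residues $0,1,\dots,(p-1)/t-1$ when computing $\theta^m$. Let $H_{p,t}$ be the graph with vertex set $\Gamma$ in which distinct vertices $(x,y)$ and $(a,b)$ are adjacent if and only if $(x,y)+(a,b) \in S$ (addition in the group $\Gamma$). Then $H_{p,t}$ contains no subgraph isomorphic to $K_{2,t+1}$.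
   Context: $K_{2,t+1}$ is the complete bipartite graph with parts of sizes $2$ and $t+1$. -}

module Defs where

open import Data.Nat using (ℕ; _+_; _*_; _∸_; _^_; _<_; NonZero)
open import Data.Nat.DivMod using (_/_)
open import Data.Fin using (Fin; toℕ)
open import Data.Product using (Σ; ∃; ∃-syntax; _×_; _,_)
open import Data.Sum using (_⊎_; inj₁; inj₂)
open import Relation.Binary.PropositionalEquality using (_≡_; _≢_)
open import Function.Definitions using (Injective)

Cong : ℕ → ℕ → ℕ → Set
Cong n a b = (∃[ k ] (a ≡ b + k * n)) ⊎ (∃[ k ] (b ≡ a + k * n))

IsGenerator : ℕ → ℕ → Set
IsGenerator p θ = θ < p × (∀ y → 0 < y → y < p → ∃[ k ] Cong p (θ ^ k) y)

module _ (p θ t : ℕ) .{{_ : NonZero t}} where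

  q : ℕ
  q = (p ∸ 1) / t

  μ : ℕ
  μ = θ ^ q

  Γ : Set
  Γ = Fin q × Fin p

  -- (s₁ , s₂) ∈ S, with s₁ , s₂ given by representatives modulo q and p:
  -- ∃ m ∈ {0..q-1}, n ∈ {0..t-1}, s₁ ≡ m (mod q), s₂ ≡ θ^m μ^n (mod p)
  InS : ℕ → ℕ → Set
  InS s₁ s₂ = ∃[ m ] ∃[ n ] (m < q × n < t × Cong q s₁ m × Cong p s₂ (θ ^ m * μ ^ n))

  Adj : Γ → Γ → Set
  Adj (x , y) (a , b) = (x , y) ≢ (a , b) × InS (toℕ x + toℕ a) (toℕ y + toℕ b)

  ContainsK2 : Set
  ContainsK2 = Σ (Fin 2 ⊎ Fin (t + 1) → Γ) λ f →
    Injective _≡_ _≡_ f × (∀ i j → Adj (f (inj₁ i)) (f (inj₂ j)))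

{-# OPTIONS --safe #-}

-- Put q = (p - 1)/t. As θ^m μ^n = θ^(m + q n), a sum c + w lies in S exactly when it equals
-- (E mod q, θ^E) for some E < p - 1. Let w be adjacent to two centres c ≠ c', with exponents E
-- and E', and let s ≡ E - E' (mod p - 1). Then s ≡ c₁ - c'₁ (mod q), which leaves only t values
-- below p - 1 = q t for s, so two of t + 1 common neighbours share the same s. Also
-- (c'₂ + w₂) θ^s ≡ c₂ + w₂ (mod p), and s ≠ 0 because c ≠ c', so θ^s ≢ 1 as θ has order p - 1.
-- Hence w₂ is the unique fixed point of the affine map y ↦ (c'₂ + y) θ^s - c₂ on F_p, and w₂
-- determines the neighbour w of c: the two common neighbours coincide.

module Submission where

open import Defs
open import Data.Nat
  using (ℕ; NonZero; zero; suc; _<_; _≤_; _∸_; _%_; _/_; nonTrivial⇒≢1; nonTrivial⇒n>1)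
import Data.Nat as ℕ
import Data.Nat.Properties as ℕ
open import Data.Nat.DivMod
  using (m≡m%n+[m/n]*n; m%n<n; m/n*n≡m; m<n*o⇒m/o<n; %-remove-+ˡ; m<n⇒m%n≡m)
open import Data.Nat.Divisibility using (_∣_; divides; ∣1⇒≡1; m%n≡0⇒n∣m)
open import Data.Nat.Primality using (Prime; euclidsLemma; prime⇒nonTrivial; prime⇒nonZero)
open import Data.Integer using (ℤ; +_; -_; _+_; _-_; _*_; _^_; 0ℤ; 1ℤ; ∣_∣)
import Data.Integer.Properties as ℤ
import Data.Integer.Divisibility.Signed as ℤ
open import Data.Integer.Divisibility.Signed using (∣⇒∣ᵤ; ∣ᵤ⇒∣)
open import Data.Integer.Tactic.RingSolver using (solve-∀)
open import Data.Fin using (Fin; toℕ; fromℕ<)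
import Data.Fin.Properties as Fin
open import Data.Fin.Patterns using (0F; 1F)
open import Data.Product using (_×_; _,_; ∃; ∃₂; proj₁; proj₂)
open import Data.Sum using (_⊎_; inj₁; inj₂)
import Data.Sum as Sum
open import Data.Sum.Properties using (inj₂-injective)
open import Data.Empty using (⊥-elim)
open import Function using (_∘_; _$_)
open import Relation.Nullary using (¬_)
open import Relation.Binary.Bundles using (Setoid)
open import Relation.Binary.Structures using (IsEquivalence)
open import Relation.Binary.Definitions using (tri<; tri≈; tri>)
open import Relation.Binary.PropositionalEquality
  using (_≡_; _≢_; refl; sym; trans; cong; cong₂; subst; module ≡-Reasoning)
import Relation.Binary.Reasoning.Setoid as SetoidReasoning

-- A record rather than a definition, so that a and b can be inferred from the type.
infix 4 _≡_mod_
record _≡_mod_ (a b : ℤ) (n : ℕ) : Set where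
  constructor ∣-difference
  field n∣a-b : + n ℤ.∣ a - b

module _ {n : ℕ} where

  mod-reflexive : ∀ {a b} → a ≡ b → a ≡ b mod n
  mod-reflexive {a} refl = ∣-difference (ℤ.divides 0ℤ (ℤ.+-inverseʳ a))

  mod-refl : ∀ {a} → a ≡ a mod n
  mod-refl = mod-reflexive refl

  mod-sym : ∀ {a b} → a ≡ b mod n → b ≡ a mod n
  mod-sym {a} {b} (∣-difference n∣a-b) =
    ∣-difference $ subst (+ n ℤ.∣_) (negate a b) (ℤ.∣m⇒∣-m n∣a-b)
    where
    negate : ∀ a b → - (a - b) ≡ b - a
    negate = solve-∀

  mod-trans : ∀ {a b c} → a ≡ b mod n → b ≡ c mod n → a ≡ c mod n
  mod-trans {a} {b} {c} (∣-difference n∣a-b) (∣-difference n∣b-c) =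
    ∣-difference $ subst (+ n ℤ.∣_) (telescope a b c) (ℤ.∣m∣n⇒∣m+n n∣a-b n∣b-c)
    where
    telescope : ∀ a b c → (a - b) + (b - c) ≡ a - c
    telescope = solve-∀

  +-cong-mod : ∀ {a b c d} → a ≡ b mod n → c ≡ d mod n → a + c ≡ b + d mod n
  +-cong-mod {a} {b} {c} {d} (∣-difference n∣a-b) (∣-difference n∣c-d) =
    ∣-difference $ subst (+ n ℤ.∣_) (regroup a b c d) (ℤ.∣m∣n⇒∣m+n n∣a-b n∣c-d)
    where
    regroup : ∀ a b c d → (a - b) + (c - d) ≡ (a + c) - (b + d)
    regroup = solve-∀

  *-cong-mod : ∀ {a b c d} → a ≡ b mod n → c ≡ d mod n → a * c ≡ b * d mod n
  *-cong-mod {a} {b} {c} {d} (∣-difference n∣a-b) (∣-difference n∣c-d) =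
    ∣-difference $ subst (+ n ℤ.∣_) (regroup a b c d)
                     (ℤ.∣m∣n⇒∣m+n (ℤ.∣m⇒∣m*n c n∣a-b) (ℤ.∣n⇒∣m*n b n∣c-d))
    where
    regroup : ∀ a b c d → (a - b) * c + b * (c - d) ≡ a * c - b * d
    regroup = solve-∀

  *-congˡ-mod : ∀ c {a b} → a ≡ b mod n → c * a ≡ c * b mod n
  *-congˡ-mod c = *-cong-mod (mod-refl {c})

  *-congʳ-mod : ∀ c {a b} → a ≡ b mod n → a * c ≡ b * c mod n
  *-congʳ-mod c a≡b = *-cong-mod a≡b (mod-refl {c})

  +-congˡ-mod : ∀ c {a b} → a ≡ b mod n → c + a ≡ c + b mod n
  +-congˡ-mod c = +-cong-mod (mod-refl {c})

  +-congʳ-mod : ∀ c {a b} → a ≡ b mod n → a + c ≡ b + c mod n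
  +-congʳ-mod c a≡b = +-cong-mod a≡b (mod-refl {c})

  +-cancelˡ-mod : ∀ c {a b} → c + a ≡ c + b mod n → a ≡ b mod n
  +-cancelˡ-mod c {a} {b} (∣-difference n∣c+a-c+b) =
    ∣-difference (subst (+ n ℤ.∣_) (cancel c a b) n∣c+a-c+b)
    where
    cancel : ∀ c a b → c + a - (c + b) ≡ a - b
    cancel = solve-∀

  +-cancelʳ-mod : ∀ c {a b} → a + c ≡ b + c mod n → a ≡ b mod n
  +-cancelʳ-mod c {a} {b} (∣-difference n∣a+c-b+c) =
    ∣-difference (subst (+ n ℤ.∣_) (cancel c a b) n∣a+c-b+c)
    where
    cancel : ∀ c a b → a + c - (b + c) ≡ a - b
    cancel = solve-∀

  mod-isEquivalence : IsEquivalence (λ a b → a ≡ b mod n)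
  mod-isEquivalence = record { refl = mod-refl ; sym = mod-sym ; trans = mod-trans }

modSetoid : ℕ → Setoid _ _
modSetoid n = record { isEquivalence = mod-isEquivalence {n} }

mod-+-multiple : ∀ {n} a k → a + k * + n ≡ a mod n
mod-+-multiple {n} a k = ∣-difference (ℤ.divides k (cancel a (k * + n)))
  where
  cancel : ∀ a c → a + c - a ≡ c
  cancel = solve-∀

multiple⇒mod : ∀ {n a b} k → a ≡ b ℕ.+ k ℕ.* n → + a ≡ + b mod n
multiple⇒mod {n} {b = b} k refl =
  subst (_≡ + b mod n) (sym pos-+-multiple) (mod-+-multiple (+ b) (+ k))
  where
  pos-+-multiple : + (b ℕ.+ k ℕ.* n) ≡ + b + + k * + n
  pos-+-multiple = trans (ℤ.pos-+ b (k ℕ.* n)) (cong (λ c → + b + c) (ℤ.pos-* k n))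

Cong⇒mod : ∀ {n a b} → Cong n a b → + a ≡ + b mod n
Cong⇒mod (inj₁ (k , a≡b+kn)) = multiple⇒mod k a≡b+kn
Cong⇒mod (inj₂ (k , b≡a+kn)) = mod-sym (multiple⇒mod k b≡a+kn)

%-mod : ∀ m n .{{_ : NonZero n}} → + m ≡ + (m % n) mod n
%-mod m n = Cong⇒mod (inj₁ (m / n , m≡m%n+[m/n]*n m n))

mod⇒∣∸ : ∀ {n a b} → b ≤ a → + a ≡ + b mod n → n ∣ a ∸ b
mod⇒∣∸ {n} {a} {b} b≤a (∣-difference n∣a-b) =
  subst (n ∣_) (cong ∣_∣ (trans (ℤ.m-n≡m⊖n a b) (ℤ.⊖-≥ b≤a))) (∣⇒∣ᵤ n∣a-b)

∣∸⇒%≡ : ∀ {n a b} .{{_ : NonZero n}} → b ≤ a → n ∣ a ∸ b → a % n ≡ b % n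
∣∸⇒%≡ {n} {a} {b} b≤a n∣a∸b = begin
  a % n             ≡⟨ cong (_% n) (ℕ.m∸n+n≡m b≤a) ⟨
  (a ∸ b ℕ.+ b) % n ≡⟨ %-remove-+ˡ b n∣a∸b ⟩
  b % n             ∎
  where open ≡-Reasoning

mod⇒%≡ : ∀ {n a b} .{{_ : NonZero n}} → + a ≡ + b mod n → a % n ≡ b % n
mod⇒%≡ {n} {a} {b} a≡b with ℕ.≤-total b a
... | inj₁ b≤a = ∣∸⇒%≡ b≤a (mod⇒∣∸ b≤a a≡b)
... | inj₂ a≤b = sym (∣∸⇒%≡ a≤b (mod⇒∣∸ a≤b (mod-sym a≡b)))

mod⇒≡ : ∀ {n a b} → a < n → b < n → + a ≡ + b mod n → a ≡ b
mod⇒≡ {n} {a} {b} a<n b<n a≡b = begin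
  a     ≡⟨ m<n⇒m%n≡m a<n ⟨
  a % n ≡⟨ mod⇒%≡ a≡b ⟩
  b % n ≡⟨ m<n⇒m%n≡m b<n ⟩
  b     ∎
  where
  open ≡-Reasoning
  instance
    n-nonZero : NonZero n
    n-nonZero = ℕ.>-nonZero (ℕ.≤-<-trans ℕ.z≤n a<n)

mod-weaken : ∀ {d n a b} → d ∣ n → a ≡ b mod n → a ≡ b mod d
mod-weaken d∣n (∣-difference n∣a-b) = ∣-difference (ℤ.∣-trans (∣ᵤ⇒∣ d∣n) n∣a-b)

∣⇒≡0-mod : ∀ {n a} → + n ℤ.∣ a → a ≡ 0ℤ mod n
∣⇒≡0-mod {n} {a} n∣a = ∣-difference (subst (+ n ℤ.∣_) (sym (ℤ.+-identityʳ a)) n∣a)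

pos-^ : ∀ m k → + (m ℕ.^ k) ≡ (+ m) ^ k
pos-^ m zero    = refl
pos-^ m (suc k) = trans (ℤ.pos-* m (m ℕ.^ k)) (cong (+ m *_) (pos-^ m k))

module _ {p : ℕ} (p-prime : Prime p) where

  euclidsLemmaℤ : ∀ a b → + p ℤ.∣ a * b → + p ℤ.∣ a ⊎ + p ℤ.∣ b
  euclidsLemmaℤ a b p∣ab =
    Sum.map ∣ᵤ⇒∣ ∣ᵤ⇒∣ (euclidsLemma ∣ a ∣ ∣ b ∣ p-prime (subst (p ∣_) (ℤ.abs-* a b) (∣⇒∣ᵤ p∣ab)))

  prime∤^ : ∀ {g} → ¬ (+ p ℤ.∣ g) → ∀ k → ¬ (+ p ℤ.∣ g ^ k)
  prime∤^ p∤g zero    p∣1 = nonTrivial⇒≢1 {{prime⇒nonTrivial p-prime}} (∣1⇒≡1 (∣⇒∣ᵤ p∣1))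
  prime∤^ p∤g (suc k) p∣g^[1+k] with euclidsLemmaℤ _ _ p∣g^[1+k]
  ... | inj₁ p∣g   = p∤g p∣g
  ... | inj₂ p∣g^k = prime∤^ p∤g k p∣g^k

  *-cancelˡ-mod : ∀ {a b c} → ¬ (+ p ℤ.∣ c) → c * a ≡ c * b mod p → a ≡ b mod p
  *-cancelˡ-mod {a} {b} {c} p∤c (∣-difference p∣ca-cb) =
    Sum.[ ⊥-elim ∘ p∤c , ∣-difference ]′
      (euclidsLemmaℤ c (a - b) (subst (+ p ℤ.∣_) (factor c a b) p∣ca-cb))
    where
    factor : ∀ c a b → c * a - c * b ≡ c * (a - b)
    factor = solve-∀

  affine-fixedPoint-unique : ∀ {T c d y₁ y₂} → ¬ (T ≡ 1ℤ mod p) →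
    (c + y₁) * T ≡ d + y₁ mod p → (c + y₂) * T ≡ d + y₂ mod p → y₁ ≡ y₂ mod p
  affine-fixedPoint-unique {T} {c} {d} {y₁} {y₂} T≢1 (∣-difference p∣fix₁) (∣-difference p∣fix₂) =
    Sum.[ ∣-difference , ⊥-elim ∘ T≢1 ∘ ∣-difference ]′
      (euclidsLemmaℤ (y₁ - y₂) (T - 1ℤ)
        (subst (+ p ℤ.∣_) (factor T c d y₁ y₂) (ℤ.∣m∣n⇒∣m-n p∣fix₁ p∣fix₂)))
    where
    factor : ∀ T c d y₁ y₂ →
             ((c + y₁) * T - (d + y₁)) - ((c + y₂) * T - (d + y₂)) ≡ (y₁ - y₂) * (T - 1ℤ)
    factor = solve-∀

%-/-injective : ∀ {n a b} .{{_ : NonZero n}} → a % n ≡ b % n → a / n ≡ b / n → a ≡ b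
%-/-injective {n} {a} {b} a%n≡b%n a/n≡b/n = begin
  a                     ≡⟨ m≡m%n+[m/n]*n a n ⟩
  a % n ℕ.+ a / n ℕ.* n ≡⟨ cong₂ (λ r k → r ℕ.+ k ℕ.* n) a%n≡b%n a/n≡b/n ⟩
  b % n ℕ.+ b / n ℕ.* n ≡⟨ m≡m%n+[m/n]*n b n ⟨
  b                     ∎
  where open ≡-Reasoning

pigeonhole-< : ∀ {m n} → m < n → (f : Fin n → ℕ) → (∀ i → f i < m) →
               ∃₂ λ i j → toℕ i < toℕ j × f i ≡ f j
pigeonhole-< m<n f f<m with Fin.pigeonhole m<n (λ i → fromℕ< (f<m i))
... | i , j , i<j , same = i , j , i<j , (begin
  f i                   ≡⟨ Fin.toℕ-fromℕ< (f<m i) ⟨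
  toℕ (fromℕ< (f<m i)) ≡⟨ cong toℕ same ⟩
  toℕ (fromℕ< (f<m j)) ≡⟨ Fin.toℕ-fromℕ< (f<m j) ⟩
  f j                   ∎)
  where open ≡-Reasoning

<∸1⇒suc< : ∀ {m n} → m < n ∸ 1 → suc m < n
<∸1⇒suc< {n = zero}  ()
<∸1⇒suc< {n = suc n} m<n = ℕ.s<s m<n

record IsOrder (n : ℕ) (g : ℤ) (d : ℕ) : Set where
  field
    ^-order≡1       : g ^ d ≡ 1ℤ mod n
    ^-below-order≢1 : ∀ {e} → 0 < e → e < d → ¬ (g ^ e ≡ 1ℤ mod n)

module _ {n d : ℕ} {g : ℤ} where
  open SetoidReasoning (modSetoid n)

  ^-multiple≡1 : g ^ d ≡ 1ℤ mod n → ∀ k → g ^ (k ℕ.* d) ≡ 1ℤ mod n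
  ^-multiple≡1 g^d≡1 zero    = mod-refl
  ^-multiple≡1 g^d≡1 (suc k) = begin
    g ^ (d ℕ.+ k ℕ.* d)   ≡⟨ ℤ.^-distribˡ-+-* g d (k ℕ.* d) ⟩
    g ^ d * g ^ (k ℕ.* d) ≈⟨ *-cong-mod g^d≡1 (^-multiple≡1 g^d≡1 k) ⟩
    1ℤ * 1ℤ               ≡⟨⟩
    1ℤ                    ∎

  ^-%-period : .{{_ : NonZero d}} → g ^ d ≡ 1ℤ mod n → ∀ a → g ^ a ≡ g ^ (a % d) mod n
  ^-%-period g^d≡1 a = begin
    g ^ a                               ≡⟨ cong (g ^_) (m≡m%n+[m/n]*n a d) ⟩
    g ^ (a % d ℕ.+ a / d ℕ.* d)         ≡⟨ ℤ.^-distribˡ-+-* g (a % d) (a / d ℕ.* d) ⟩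
    g ^ (a % d) * g ^ (a / d ℕ.* d)     ≈⟨ *-congˡ-mod (g ^ (a % d)) (^-multiple≡1 g^d≡1 (a / d)) ⟩
    g ^ (a % d) * 1ℤ                    ≡⟨ ℤ.*-identityʳ (g ^ (a % d)) ⟩
    g ^ (a % d)                         ∎

  ^-cong-period : .{{_ : NonZero d}} → g ^ d ≡ 1ℤ mod n →
                  ∀ {a b} → + a ≡ + b mod d → g ^ a ≡ g ^ b mod n
  ^-cong-period g^d≡1 {a} {b} a≡b = begin
    g ^ a       ≈⟨ ^-%-period g^d≡1 a ⟩
    g ^ (a % d) ≡⟨ cong (g ^_) (mod⇒%≡ a≡b) ⟩
    g ^ (b % d) ≈⟨ ^-%-period g^d≡1 b ⟨
    g ^ b       ∎

  module _ (order : IsOrder n g d) where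
    open IsOrder order

    ^-distinct-below-order : ∀ {a b} → a < b → b < d → ¬ (g ^ a ≡ g ^ b mod n)
    ^-distinct-below-order {a} {b} a<b b<d g^a≡g^b =
      ^-below-order≢1 0<e e<d g^e≡1
      where
      e : ℕ
      e = a ℕ.+ (d ∸ b)
      0<e : 0 < e
      0<e = ℕ.≤-trans (ℕ.m<n⇒0<n∸m b<d) (ℕ.m≤n+m (d ∸ b) a)
      e<d : e < d
      e<d = subst (e <_) (ℕ.m+[n∸m]≡n (ℕ.<⇒≤ b<d)) (ℕ.+-monoˡ-< (d ∸ b) a<b)
      g^e≡1 : g ^ e ≡ 1ℤ mod n
      g^e≡1 = begin
        g ^ (a ℕ.+ (d ∸ b))   ≡⟨ ℤ.^-distribˡ-+-* g a (d ∸ b) ⟩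
        g ^ a * g ^ (d ∸ b)   ≈⟨ *-congʳ-mod (g ^ (d ∸ b)) g^a≡g^b ⟩
        g ^ b * g ^ (d ∸ b)   ≡⟨ ℤ.^-distribˡ-+-* g b (d ∸ b) ⟨
        g ^ (b ℕ.+ (d ∸ b))   ≡⟨ cong (g ^_) (ℕ.m+[n∸m]≡n (ℕ.<⇒≤ b<d)) ⟩
        g ^ d                 ≈⟨ ^-order≡1 ⟩
        1ℤ                    ∎

    ^-injective-below-order : ∀ {a b} → a < d → b < d → g ^ a ≡ g ^ b mod n → a ≡ b
    ^-injective-below-order {a} {b} a<d b<d g^a≡g^b with ℕ.<-cmp a b
    ... | tri< a<b _ _ = ⊥-elim (^-distinct-below-order a<b b<d g^a≡g^b)
    ... | tri≈ _ a≡b _ = a≡b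
    ... | tri> _ _ b<a = ⊥-elim (^-distinct-below-order b<a a<d (mod-sym g^a≡g^b))

module _ {p θ : ℕ} (gen : IsGenerator p θ) where
  open SetoidReasoning (modSetoid p)

  discreteLog : ∀ y → 0 < y → y < p → ∃ λ k → (+ θ) ^ k ≡ + y mod p
  discreteLog y 0<y y<p with proj₂ gen y 0<y y<p
  ... | k , θ^k≡y = k , subst (_≡ + y mod p) (pos-^ θ k) (Cong⇒mod θ^k≡y)

  1+i<p : (i : Fin (p ∸ 1)) → suc (toℕ i) < p
  1+i<p i = <∸1⇒suc< (Fin.toℕ<n i)

  log1+ : Fin (p ∸ 1) → ℕ
  log1+ i = proj₁ (discreteLog (suc (toℕ i)) ℕ.z<s (1+i<p i))

  ^-log1+ : ∀ i → (+ θ) ^ log1+ i ≡ + suc (toℕ i) mod p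
  ^-log1+ i = proj₂ (discreteLog (suc (toℕ i)) ℕ.z<s (1+i<p i))

  -- Otherwise the p - 1 nonzero residues would all be among θ^0, …, θ^(e - 1).
  generator-^≢1 : ∀ {e} .{{_ : NonZero e}} → e < p ∸ 1 → ¬ ((+ θ) ^ e ≡ 1ℤ mod p)
  generator-^≢1 {e} e<p∸1 θ^e≡1
    with pigeonhole-< e<p∸1 (λ i → log1+ i % e) (λ i → m%n<n (log1+ i) e)
  ... | i , j , i<j , logᵢ≡logⱼ =
    ℕ.<-irrefl (ℕ.suc-injective (mod⇒≡ (1+i<p i) (1+i<p j) 1+i≡1+j)) i<j
    where
    1+i≡1+j : + suc (toℕ i) ≡ + suc (toℕ j) mod p
    1+i≡1+j = begin
      + suc (toℕ i)          ≈⟨ ^-log1+ i ⟨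
      (+ θ) ^ log1+ i        ≈⟨ ^-%-period θ^e≡1 (log1+ i) ⟩
      (+ θ) ^ (log1+ i % e)  ≡⟨ cong ((+ θ) ^_) logᵢ≡logⱼ ⟩
      (+ θ) ^ (log1+ j % e)  ≈⟨ ^-%-period θ^e≡1 (log1+ j) ⟨
      (+ θ) ^ log1+ j        ≈⟨ ^-log1+ j ⟩
      + suc (toℕ j)          ∎

  generator-coprime : 2 < p → ¬ (+ p ℤ.∣ + θ)
  generator-coprime 2<p p∣θ with discreteLog 2 ℕ.z<s 2<p
  ... | zero  , 1≡2       = ℕ.1+n≢n (sym (mod⇒≡ (ℕ.<-trans (ℕ.n<1+n 1) 2<p) 2<p 1≡2))
  ... | suc k , θ^[1+k]≡2 = ℕ.0≢1+n (mod⇒≡ (ℕ.<-trans ℕ.z<s 2<p) 2<p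
                                       (mod-trans (mod-sym θ^[1+k]≡0) θ^[1+k]≡2))
    where
    θ^[1+k]≡0 : (+ θ) ^ suc k ≡ 0ℤ mod p
    θ^[1+k]≡0 = ∣⇒≡0-mod (ℤ.∣m⇒∣m*n ((+ θ) ^ k) p∣θ)

  module _ (p-prime : Prime p) (2<p : 2 < p) where
    instance
      p-nonZero : NonZero p
      p-nonZero = prime⇒nonZero p-prime

    residue : ℕ → ℕ
    residue k = θ ℕ.^ k % p

    ^-residue : ∀ k → (+ θ) ^ k ≡ + residue k mod p
    ^-residue k = subst (_≡ + residue k mod p) (pos-^ θ k) (%-mod (θ ℕ.^ k) p)

    residue-positive : ∀ k → 0 < residue k
    residue-positive k = ℕ.n≢0⇒n>0 λ residue≡0 →
      prime∤^ p-prime (generator-coprime 2<p) k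
        (subst (+ p ℤ.∣_) (pos-^ θ k) (∣ᵤ⇒∣ (m%n≡0⇒n∣m (θ ℕ.^ k) p residue≡0)))

    -- Two of the p powers θ^0, …, θ^(p - 1) share one of the p - 1 nonzero residues.
    ^-returns-to-1 : ∃ λ d → 0 < d × d ≤ p ∸ 1 × (+ θ) ^ d ≡ 1ℤ mod p
    ^-returns-to-1
      with pigeonhole-< (ℕ.∸-monoʳ-< ℕ.z<s (ℕ.>-nonZero⁻¹ p)) (λ k → residue (toℕ k) ∸ 1)
             (λ k → ℕ.∸-monoˡ-< (m%n<n (θ ℕ.^ toℕ k) p) (residue-positive (toℕ k)))
    ... | i , j , i<j , same = toℕ j ∸ toℕ i , ℕ.m<n⇒0<n∸m i<j , d≤p∸1 , θ^d≡1
      where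
      i+d≡j : toℕ i ℕ.+ (toℕ j ∸ toℕ i) ≡ toℕ j
      i+d≡j = ℕ.m+[n∸m]≡n (ℕ.<⇒≤ i<j)
      d≤p∸1 : toℕ j ∸ toℕ i ≤ p ∸ 1
      d≤p∸1 = ℕ.≤-trans (ℕ.m∸n≤m (toℕ j) (toℕ i)) (ℕ.∸-monoˡ-≤ 1 (Fin.toℕ<n j))
      residueᵢ≡residueⱼ : residue (toℕ i) ≡ residue (toℕ j)
      residueᵢ≡residueⱼ = ℕ.∸-cancelʳ-≡ (residue-positive (toℕ i)) (residue-positive (toℕ j)) same
      θ^i≡θ^j : (+ θ) ^ toℕ i ≡ (+ θ) ^ toℕ j mod p
      θ^i≡θ^j = begin
        (+ θ) ^ toℕ i      ≈⟨ ^-residue (toℕ i) ⟩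
        + residue (toℕ i)  ≡⟨ cong +_ residueᵢ≡residueⱼ ⟩
        + residue (toℕ j)  ≈⟨ ^-residue (toℕ j) ⟨
        (+ θ) ^ toℕ j      ∎
      p∤θ^i : ¬ (+ p ℤ.∣ (+ θ) ^ toℕ i)
      p∤θ^i = prime∤^ p-prime (generator-coprime 2<p) (toℕ i)
      θ^i*θ^d≡θ^i*1 : (+ θ) ^ toℕ i * (+ θ) ^ (toℕ j ∸ toℕ i) ≡ (+ θ) ^ toℕ i * 1ℤ mod p
      θ^i*θ^d≡θ^i*1 = begin
        (+ θ) ^ toℕ i * (+ θ) ^ (toℕ j ∸ toℕ i)  ≡⟨ ℤ.^-distribˡ-+-* (+ θ) (toℕ i) (toℕ j ∸ toℕ i) ⟨
        (+ θ) ^ (toℕ i ℕ.+ (toℕ j ∸ toℕ i))     ≡⟨ cong ((+ θ) ^_) i+d≡j ⟩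
        (+ θ) ^ toℕ j                           ≈⟨ θ^i≡θ^j ⟨
        (+ θ) ^ toℕ i                           ≡⟨ ℤ.*-identityʳ ((+ θ) ^ toℕ i) ⟨
        (+ θ) ^ toℕ i * 1ℤ                      ∎
      θ^d≡1 : (+ θ) ^ (toℕ j ∸ toℕ i) ≡ 1ℤ mod p
      θ^d≡1 = *-cancelˡ-mod p-prime {(+ θ) ^ (toℕ j ∸ toℕ i)} {1ℤ} {(+ θ) ^ toℕ i}
                p∤θ^i θ^i*θ^d≡θ^i*1

    generator-order : IsOrder p (+ θ) (p ∸ 1)
    generator-order = record
      { ^-order≡1       = ^[p∸1]≡1
      ; ^-below-order≢1 = λ 0<e → generator-^≢1 {{ℕ.>-nonZero 0<e}}
      }
      where
      ^[p∸1]≡1 : (+ θ) ^ (p ∸ 1) ≡ 1ℤ mod p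
      ^[p∸1]≡1 =
        let d , 0<d , d≤p∸1 , θ^d≡1 = ^-returns-to-1
        in Sum.[ (λ d<p∸1 → ⊥-elim (generator-^≢1 {{ℕ.>-nonZero 0<d}} d<p∸1 θ^d≡1))
               , (λ d≡p∸1 → subst (λ e → (+ θ) ^ e ≡ 1ℤ mod p) d≡p∸1 θ^d≡1)
               ]′ (ℕ.m≤n⇒m<n∨m≡n d≤p∸1)

module _ (p θ t : ℕ) .{{_ : NonZero t}} (p-prime : Prime p) (2<p : 2 < p)
         (gen : IsGenerator p θ) (t∣p∸1 : t ∣ p ∸ 1) where

  θ-order : IsOrder p (+ θ) (p ∸ 1)
  θ-order = generator-order gen p-prime 2<p
  open IsOrder θ-order

  Q : ℕ
  Q = q p θ t

  Q*t≡p∸1 : Q ℕ.* t ≡ p ∸ 1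
  Q*t≡p∸1 = m/n*n≡m t∣p∸1

  p∸1≡t*Q : p ∸ 1 ≡ t ℕ.* Q
  p∸1≡t*Q = trans (sym Q*t≡p∸1) (ℕ.*-comm Q t)

  Q∣p∸1 : Q ∣ p ∸ 1
  Q∣p∸1 = divides t p∸1≡t*Q

  instance
    p∸1-nonZero : NonZero (p ∸ 1)
    p∸1-nonZero = ℕ.>-nonZero (ℕ.∸-monoˡ-< (ℕ.<-trans (ℕ.n<1+n 1) 2<p) ℕ.≤-refl)

    Q-nonZero : NonZero Q
    Q-nonZero = ℕ.m*n≢0⇒m≢0 Q {{subst NonZero (sym Q*t≡p∸1) p∸1-nonZero}}

  Vertex : Set
  Vertex = Γ p θ t

  ι₁ : Vertex → ℤ
  ι₁ (a , _) = + toℕ a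

  ι₂ : Vertex → ℤ
  ι₂ (_ , b) = + toℕ b

  ι-injective : ∀ {c c'} → ι₁ c ≡ ι₁ c' mod Q → ι₂ c ≡ ι₂ c' mod p → c ≡ c'
  ι-injective {a , b} {a' , b'} a≡a' b≡b' = cong₂ _,_
    (Fin.toℕ-injective (mod⇒≡ (Fin.toℕ<n a) (Fin.toℕ<n a') a≡a'))
    (Fin.toℕ-injective (mod⇒≡ (Fin.toℕ<n b) (Fin.toℕ<n b') b≡b'))

  record SumExponent (c w : Vertex) : Set where
    field
      E          : ℕ
      E<p∸1      : E < p ∸ 1
      ι₁-sum≡E   : ι₁ c + ι₁ w ≡ + E mod Q
      ι₂-sum≡θ^E : ι₂ c + ι₂ w ≡ (+ θ) ^ E mod p
  open SumExponent

  Adj⇒SumExponent : ∀ {c w} → Adj p θ t c w → SumExponent c w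
  Adj⇒SumExponent {a , b} {x , y} (_ , m , n , m<Q , n<t , a+x≡m , b+y≡θ^mμ^n) = record
    { E          = m ℕ.+ Q ℕ.* n
    ; E<p∸1      = begin-strict
        m ℕ.+ Q ℕ.* n <⟨ ℕ.+-monoˡ-< (Q ℕ.* n) m<Q ⟩
        Q ℕ.+ Q ℕ.* n ≡⟨ ℕ.*-suc Q n ⟨
        Q ℕ.* suc n   ≤⟨ ℕ.*-monoʳ-≤ Q n<t ⟩
        Q ℕ.* t       ≡⟨ Q*t≡p∸1 ⟩
        p ∸ 1         ∎
    ; ι₁-sum≡E   = mod-trans (mod-reflexive (sym (ℤ.pos-+ (toℕ a) (toℕ x))))
                     (mod-trans (Cong⇒mod a+x≡m)
                       (mod-sym (multiple⇒mod n (cong (m ℕ.+_) (ℕ.*-comm Q n)))))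
    ; ι₂-sum≡θ^E = mod-trans (mod-reflexive (sym (ℤ.pos-+ (toℕ b) (toℕ y))))
                     (mod-trans (Cong⇒mod b+y≡θ^mμ^n) (mod-reflexive θ^mμ^n≡θ^E))
    }
    where
    open ℕ.≤-Reasoning
    θ^mθ^Qn≡θ^[m+Qn] : θ ℕ.^ m ℕ.* (θ ℕ.^ Q) ℕ.^ n ≡ θ ℕ.^ (m ℕ.+ Q ℕ.* n)
    θ^mθ^Qn≡θ^[m+Qn] = trans (cong (θ ℕ.^ m ℕ.*_) (ℕ.^-*-assoc θ Q n))
                             (sym (ℕ.^-distribˡ-+-* θ m (Q ℕ.* n)))
    θ^mμ^n≡θ^E : + (θ ℕ.^ m ℕ.* μ p θ t ℕ.^ n) ≡ (+ θ) ^ (m ℕ.+ Q ℕ.* n)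
    θ^mμ^n≡θ^E = trans (cong +_ θ^mθ^Qn≡θ^[m+Qn]) (pos-^ θ (m ℕ.+ Q ℕ.* n))

  neighbour-determined-by-ι₂ : ∀ {c w w'} → SumExponent c w → SumExponent c w' →
                               ι₂ w ≡ ι₂ w' mod p → w ≡ w'
  neighbour-determined-by-ι₂ {c} {w} {w'} e e' w₂≡w'₂ =
    ι-injective (+-cancelˡ-mod (ι₁ c) c+w≡c+w') w₂≡w'₂
    where
    E≡E' : E e ≡ E e'
    E≡E' = ^-injective-below-order θ-order (E<p∸1 e) (E<p∸1 e') (begin
      (+ θ) ^ E e    ≈⟨ ι₂-sum≡θ^E e ⟨
      ι₂ c + ι₂ w    ≈⟨ +-congˡ-mod (ι₂ c) w₂≡w'₂ ⟩
      ι₂ c + ι₂ w'   ≈⟨ ι₂-sum≡θ^E e' ⟩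
      (+ θ) ^ E e'   ∎)
      where open SetoidReasoning (modSetoid p)
    c+w≡c+w' : ι₁ c + ι₁ w ≡ ι₁ c + ι₁ w' mod Q
    c+w≡c+w' = begin
      ι₁ c + ι₁ w    ≈⟨ ι₁-sum≡E e ⟩
      + E e          ≡⟨ cong +_ E≡E' ⟩
      + E e'         ≈⟨ ι₁-sum≡E e' ⟨
      ι₁ c + ι₁ w'   ∎
      where open SetoidReasoning (modSetoid Q)

  -- E - E' reduced modulo p - 1, arranged to avoid truncated subtraction (E' < p - 1).
  shift : ∀ {c c' w} → SumExponent c w → SumExponent c' w → ℕ
  shift e e' = (E e ℕ.+ (p ∸ 1 ∸ E e')) % (p ∸ 1)

  module _ {c c' w} (e : SumExponent c w) (e' : SumExponent c' w) where

    shift<p∸1 : shift e e' < p ∸ 1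
    shift<p∸1 = m%n<n (E e ℕ.+ (p ∸ 1 ∸ E e')) (p ∸ 1)

    E'+shift≡E : + (E e' ℕ.+ shift e e') ≡ + E e mod (p ∸ 1)
    E'+shift≡E = begin
      + (E e' ℕ.+ shift e e')                 ≡⟨ ℤ.pos-+ (E e') (shift e e') ⟩
      + E e' + + shift e e'                   ≈⟨ +-congˡ-mod (+ E e') (%-mod _ (p ∸ 1)) ⟨
      + E e' + + (E e ℕ.+ (p ∸ 1 ∸ E e'))     ≡⟨ ℤ.pos-+ (E e') (E e ℕ.+ (p ∸ 1 ∸ E e')) ⟨
      + (E e' ℕ.+ (E e ℕ.+ (p ∸ 1 ∸ E e')))  ≈⟨ multiple⇒mod 1 E'+[E+[p∸1∸E']]≡E+[p∸1] ⟩
      + E e                                   ∎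
      where
      open SetoidReasoning (modSetoid (p ∸ 1))
      E'+[E+[p∸1∸E']]≡E+[p∸1] : E e' ℕ.+ (E e ℕ.+ (p ∸ 1 ∸ E e')) ≡ E e ℕ.+ 1 ℕ.* (p ∸ 1)
      E'+[E+[p∸1∸E']]≡E+[p∸1] = trans (ℕ.+-comm (E e') _) (trans (ℕ.+-assoc (E e) _ (E e'))
        (cong (E e ℕ.+_) (trans (ℕ.m∸n+n≡m (ℕ.<⇒≤ (E<p∸1 e'))) (sym (ℕ.*-identityˡ (p ∸ 1))))))

    shift-ι₁ : ι₁ c' + + shift e e' ≡ ι₁ c mod Q
    shift-ι₁ = +-cancelʳ-mod (ι₁ w) (begin
      ι₁ c' + + shift e e' + ι₁ w   ≡⟨ swap (ι₁ c') (+ shift e e') (ι₁ w) ⟩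
      ι₁ c' + ι₁ w + + shift e e'   ≈⟨ +-congʳ-mod (+ shift e e') (ι₁-sum≡E e') ⟩
      + E e' + + shift e e'         ≡⟨ ℤ.pos-+ (E e') (shift e e') ⟨
      + (E e' ℕ.+ shift e e')       ≈⟨ mod-weaken Q∣p∸1 E'+shift≡E ⟩
      + E e                         ≈⟨ ι₁-sum≡E e ⟨
      ι₁ c + ι₁ w                   ∎)
      where
      open SetoidReasoning (modSetoid Q)
      swap : ∀ a b c → a + b + c ≡ a + c + b
      swap a b c = trans (ℤ.+-assoc a b c)
                         (trans (cong (λ d → a + d) (ℤ.+-comm b c)) (sym (ℤ.+-assoc a c b)))

    shift-ι₂ : (ι₂ c' + ι₂ w) * (+ θ) ^ shift e e' ≡ ι₂ c + ι₂ w mod p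
    shift-ι₂ = begin
      (ι₂ c' + ι₂ w) * (+ θ) ^ shift e e'  ≈⟨ *-congʳ-mod ((+ θ) ^ shift e e') (ι₂-sum≡θ^E e') ⟩
      (+ θ) ^ E e' * (+ θ) ^ shift e e'    ≡⟨ ℤ.^-distribˡ-+-* (+ θ) (E e') (shift e e') ⟨
      (+ θ) ^ (E e' ℕ.+ shift e e')        ≈⟨ ^-cong-period ^-order≡1 E'+shift≡E ⟩
      (+ θ) ^ E e                          ≈⟨ ι₂-sum≡θ^E e ⟨
      ι₂ c + ι₂ w                          ∎
      where open SetoidReasoning (modSetoid p)

    shift≡0⇒centres-equal : shift e e' ≡ 0 → c' ≡ c
    shift≡0⇒centres-equal shift≡0 = ι-injective c'₁≡c₁ c'₂≡c₂
      where
      c'₁≡c₁ : ι₁ c' ≡ ι₁ c mod Q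
      c'₁≡c₁ = begin
        ι₁ c'                ≡⟨ ℤ.+-identityʳ (ι₁ c') ⟨
        ι₁ c' + + 0          ≡⟨ cong (λ s → ι₁ c' + + s) shift≡0 ⟨
        ι₁ c' + + shift e e' ≈⟨ shift-ι₁ ⟩
        ι₁ c                 ∎
        where open SetoidReasoning (modSetoid Q)
      c'+w≡c+w : ι₂ c' + ι₂ w ≡ ι₂ c + ι₂ w mod p
      c'+w≡c+w = begin
        ι₂ c' + ι₂ w                          ≡⟨ ℤ.*-identityʳ (ι₂ c' + ι₂ w) ⟨
        (ι₂ c' + ι₂ w) * 1ℤ                   ≡⟨ cong (λ s → (ι₂ c' + ι₂ w) * (+ θ) ^ s) shift≡0 ⟨
        (ι₂ c' + ι₂ w) * (+ θ) ^ shift e e'  ≈⟨ shift-ι₂ ⟩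
        ι₂ c + ι₂ w                           ∎
        where open SetoidReasoning (modSetoid p)
      c'₂≡c₂ : ι₂ c' ≡ ι₂ c mod p
      c'₂≡c₂ = +-cancelʳ-mod (ι₂ w) c'+w≡c+w

  module _ {c c' w w'} (e : SumExponent c w) (e' : SumExponent c' w)
                       (f : SumExponent c w') (f' : SumExponent c' w') where

    shift≡shift-mod-Q : + shift e e' ≡ + shift f f' mod Q
    shift≡shift-mod-Q = +-cancelˡ-mod (ι₁ c') (mod-trans (shift-ι₁ e e') (mod-sym (shift-ι₁ f f')))

    shift-determined-by-quotient : shift e e' / Q ≡ shift f f' / Q → shift e e' ≡ shift f f'
    shift-determined-by-quotient = %-/-injective {Q} (mod⇒%≡ shift≡shift-mod-Q)

    equal-nonzero-shifts⇒same-neighbour : shift e e' ≡ shift f f' → shift e e' ≢ 0 → w ≡ w'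
    equal-nonzero-shifts⇒same-neighbour same-shift shift≢0 =
      neighbour-determined-by-ι₂ e f
        (affine-fixedPoint-unique p-prime {(+ θ) ^ shift e e'} {ι₂ c'} {ι₂ c} {ι₂ w} {ι₂ w'}
          θ^shift≢1 (shift-ι₂ e e') shift-ι₂-f)
      where
      θ^shift≢1 : ¬ ((+ θ) ^ shift e e' ≡ 1ℤ mod p)
      θ^shift≢1 = ^-below-order≢1 (ℕ.n≢0⇒n>0 shift≢0) (shift<p∸1 e e')
      shift-ι₂-f : (ι₂ c' + ι₂ w') * (+ θ) ^ shift e e' ≡ ι₂ c + ι₂ w' mod p
      shift-ι₂-f = subst (λ s → (ι₂ c' + ι₂ w') * (+ θ) ^ s ≡ ι₂ c + ι₂ w' mod p)
                         (sym same-shift) (shift-ι₂ f f')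

  shift/Q<t : ∀ {c c' w} (e : SumExponent c w) (e' : SumExponent c' w) → shift e e' / Q < t
  shift/Q<t e e' = m<n*o⇒m/o<n (subst (shift e e' <_) p∸1≡t*Q (shift<p∸1 e e'))

  ¬ContainsK2 : ¬ ContainsK2 p θ t
  ¬ContainsK2 (f , f-injective , f-adjacent) =
    let i , j , i<j , same-quotient = pigeonhole-< (ℕ.m<m+n t ℕ.z<s) quotient quotient<t
    in ℕ.<-irrefl (cong toℕ (leaf-injective i j same-quotient)) i<j
    where
    e : ∀ j → SumExponent (f (inj₁ 0F)) (f (inj₂ j))
    e j = Adj⇒SumExponent (f-adjacent 0F j)
    e' : ∀ j → SumExponent (f (inj₁ 1F)) (f (inj₂ j))
    e' j = Adj⇒SumExponent (f-adjacent 1F j)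
    quotient : Fin (t ℕ.+ 1) → ℕ
    quotient j = shift (e j) (e' j) / Q
    quotient<t : ∀ j → quotient j < t
    quotient<t j = shift/Q<t (e j) (e' j)
    distinct-centres : f (inj₁ 1F) ≢ f (inj₁ 0F)
    distinct-centres f₁≡f₀ with f-injective f₁≡f₀
    ... | ()
    leaf-injective : ∀ i j → quotient i ≡ quotient j → i ≡ j
    leaf-injective i j same-quotient = inj₂-injective (f-injective
      (equal-nonzero-shifts⇒same-neighbour (e i) (e' i) (e j) (e' j)
        (shift-determined-by-quotient (e i) (e' i) (e j) (e' j) same-quotient)
        (distinct-centres ∘ shift≡0⇒centres-equal (e i) (e' i))))

lemma4p1 : (p θ t : ℕ) .{{_ : NonZero t}} → Prime p → p ≢ 2 → IsGenerator p θ → t ∣ p ∸ 1 → ¬ ContainsK2 p θ t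
lemma4p1 p θ t p-prime p≢2 gen t∣p∸1 = ¬ContainsK2 p θ t p-prime 2<p gen t∣p∸1
  where
  2<p : 2 < p
  2<p = ℕ.≤∧≢⇒< (nonTrivial⇒n>1 p {{prime⇒nonTrivial p-prime}}) (p≢2 ∘ sym)
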